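{- Let $C$ be a dendritic face complex. For every $k>0$, every $e\in C_{k-1}$ and every sign $\beta\in\{+,-\}$, the set $\{d\in C_k: e\prec^{\beta}d\}$ is linearly ordered by $<^+$ (any two distinct elements are $<^+$-comparable).
   Context: A positive-to-one poset (POP) is a finite set $P$ with $\dim:P\to\mathbb{N}$ and binary relations $\prec^-,\prec^+$; $y\prec x$ means $y\prec^-x$ or $y\prec^+x$. Axioms: $y\prec x\Rightarrow\dim x=\dim y+1$; never both $y\prec^-x$ and $y\prec^+x$; every $x$ with $\dim x\ge1$ has exactly one $y$ with $y\prec^+x$, denoted $\gamma(x)$, and at least one $y$ with $y\prec^-x$. $\delta(x)=\{y:y\prec^-x\}$, $C_k=\dim^{ -1}(k)$; $\le$ is the reflexive-transitive closure of $\prec$. A dendritic face complex is a POP such that: it has a greatest element for $\le$; (oriented thinness) whenever $z\prec^{\beta}y\prec^{\alpha}x$ there is a unique $y'\ne y$ with $z\prec y'\prec x$, and writing $z\prec^{\beta'}y'\prec^{\alpha'}x$ the signs (as $\pm1$) satisfy $\alpha\beta=-\alpha'\beta'$; (acyclicity) $\delta(x)$ is a singleton if $\dim x=1$, nonempty if $\dim x\ge1$, and for $\dim x\ge1$ there are no $p\ge1$, $y_1,\dots,y_p\in\delta(x)$ with $\gamma(y_{i+1})\in\delta(y_i)$ ($1\le i<p$) and $\gamma(y_1)\in\delta(y_p)$. For $a,b\in C_k$, $a\triangleleft^+b$ iff there is $c\in C_{k+1}$ with $a\prec^-c$ and $b=\gamma(c)$; $<^+$ is the transitive closure of $\triangleleft^+$.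 -}

module Defs where

open import Data.Nat using (ℕ; zero; suc; _≤_; _<_)
open import Data.List using (List)
open import Data.List.Membership.Propositional using (_∈_)
open import Data.Product using (Σ; _×_; ∃)
open import Data.Sum using (_⊎_)
open import Data.Empty using (⊥)
open import Relation.Nullary using (¬_)
open import Relation.Binary.PropositionalEquality using (_≡_; _≢_)
open import Relation.Binary.Construct.Closure.ReflexiveTransitive using (Star)
open import Relation.Binary.Construct.Closure.Transitive using (TransClosure)

data Sign : Set where
  plus minus : Sign

_·_ : Sign → Sign → Sign
plus  · s     = s
minus · plus  = minus
minus · minus = plus

neg : Sign → Sign
neg plus  = minus
neg minus = plus

signed : {A : Set} → (A → A → Set) → (A → A → Set) → A → Sign → A → Set
signed R⁻ R⁺ y plus  x = R⁺ y x
signed R⁻ R⁺ y minus x = R⁻ y x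

record POP : Set₁ where
  field
    Elt    : Set
    finite : Σ (List Elt) (λ l → ∀ x → x ∈ l)
    dim    : Elt → ℕ
    _≺⁻_   : Elt → Elt → Set
    _≺⁺_   : Elt → Elt → Set

  _≺[_]_ : Elt → Sign → Elt → Set
  _≺[_]_ = signed _≺⁻_ _≺⁺_

  _≺_ : Elt → Elt → Set
  y ≺ x = (y ≺⁻ x) ⊎ (y ≺⁺ x)

  field
    dim-≺      : ∀ {x y} → y ≺ x → dim x ≡ suc (dim y)
    disjoint   : ∀ {x y} → ¬ ((y ≺⁻ x) × (y ≺⁺ x))
    γ-unique   : ∀ x → 1 ≤ dim x →
                 Σ Elt (λ y → (y ≺⁺ x) × (∀ z → z ≺⁺ x → z ≡ y))
    δ-nonempty : ∀ x → 1 ≤ dim x → ∃ (λ y → y ≺⁻ x)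

  _≤P_ : Elt → Elt → Set
  _≤P_ = Star _≺_

  -- "γ(y') ∈ δ(y)": the (unique) positive face of y' is a negative face of y
  γ∈δ : Elt → Elt → Set
  γ∈δ y' y = Σ Elt (λ w → (w ≺⁺ y') × (w ≺⁻ y))

  _◁⁺_ : Elt → Elt → Set
  a ◁⁺ b = Σ Elt (λ c → (a ≺⁻ c) × (b ≺⁺ c))

  _<⁺_ : Elt → Elt → Set
  _<⁺_ = TransClosure _◁⁺_



record IsDendritic (P : POP) : Set where
  open POP P
  field
    greatest : Σ Elt (λ ⊤ → ∀ x → x ≤P ⊤)
    thin     : ∀ {x y z} α β → z ≺[ β ] y → y ≺[ α ] x →
               Σ Elt (λ y' → (y' ≢ y)
                 × Σ Sign (λ α' → Σ Sign (λ β' →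
                     (z ≺[ β' ] y') × (y' ≺[ α' ] x) × (α · β ≡ neg (α' · β'))))
                 × (∀ y'' → y'' ≢ y → z ≺ y'' → y'' ≺ x → y'' ≡ y'))
    δ-single : ∀ x → dim x ≡ 1 → ∀ y z → y ≺⁻ x → z ≺⁻ x → y ≡ z
    acyclic  : ∀ x → 1 ≤ dim x →
               -- no cycle y₀,…,y_q (p = q+1 ≥ 1 elements) in δ(x) with
               -- γ(y_{i+1}) ∈ δ(y_i) for i < q and γ(y₀) ∈ δ(y_q)
               ¬ (Σ ℕ (λ q → Σ (ℕ → Elt) (λ ys →
                   (∀ i → i ≤ q → ys i ≺⁻ x)
                 × (∀ i → i < q → γ∈δ (ys (suc i)) (ys i))
                 × γ∈δ (ys 0) (ys q))))

-- Thinness says that an interval z ≺ · ≺ x has exactly two middle elements, with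
-- opposite sign products. Fix g = γ(x). Starting from z ≺^β d₁ ≺⁻ c ≺⁻ x, the partner of
-- c between d₁ and x is either g, or some c′ ∈ δ(x) with d₁ ≺⁺ c′, and then the partner
-- d₂ of d₁ between z and c′ satisfies z ≺^β d₂ ≺⁻ c′. Since γ(c′) ∈ δ(c), acyclicity and
-- finiteness make this walk through δ(x) terminate, at some b with z ≺^β b ≺⁻ g and
-- b ◁⁺ ⋯ ◁⁺ d through δ(x).
-- Consequently every element of codimension 3 below x lies below g, and descending from
-- the greatest element along γ we may assume that d and d′ have codimension at most 2
-- below x. In codimension 1, one of them is an input face and the other the output face
-- of x. In codimension 2 both walks end at the same b (thinness once more), and ◁⁺
-- restricted to δ(x) is deterministic, so one of the two chains extends the other.
module Submission where

open import Defs
open import Data.Nat using (ℕ; zero; suc; _+_; _∸_; _≤_; _<_; z≤n; s≤s)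
open import Data.Nat.Properties
  using (≤-refl; ≤-trans; <⇒≤; <-trans; ≤-reflexive; ≤-pred; <-irrefl; suc-injective; n<1+n;
         m≤n+m; +-suc; +-identityʳ; +-monoʳ-≤; +-monoʳ-<; m≤n⇒∃[o]m+o≡n; m∸n+n≡m)
open import Data.Fin using (Fin; toℕ)
open import Data.Fin.Properties using (pigeonhole; toℕ<n)
open import Data.List using (List; length; lookup)
open import Data.List.Relation.Unary.Any using (index)
open import Data.List.Relation.Unary.Any.Properties using (lookup-index)
open import Data.Product using (Σ; ∃; _×_; _,_; proj₁; proj₂)
open import Data.Sum using (_⊎_; inj₁; inj₂)
open import Data.Empty using (⊥-elim)
open import Function using (_∘_)
open import Induction.WellFounded using (Acc; acc; WellFounded)
open import Relation.Nullary using (¬_)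
open import Relation.Binary.PropositionalEquality using (_≡_; _≢_; refl; sym; trans; cong; cong₂; subst)
open import Relation.Binary.Construct.Closure.ReflexiveTransitive using (Star; ε; _◅_; _◅◅_)
open import Relation.Binary.Construct.Closure.Transitive using (TransClosure; [_]; _∷_)

module _ {A : Set} {R : A → A → Set} where

  last-step : ∀ {a a₁ b} → R a a₁ → Star R a₁ b → ∃ λ y → Star R a y × R y b
  last-step r ε = _ , ε , r
  last-step r (r₁ ◅ p) with last-step r₁ p
  ... | y , q , s = y , r ◅ q , s

  ◅⇒⁺ : ∀ {a b c} → R a b → Star R b c → TransClosure R a c
  ◅⇒⁺ r ε = [ r ]
  ◅⇒⁺ r (r₁ ◅ p) = r ∷ ◅⇒⁺ r₁ p

  deterministic⇒Star-comparable : (∀ {a b c} → R a b → R a c → b ≡ c) →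
    ∀ {a b c} → Star R a b → Star R a c → b ≡ c ⊎ TransClosure R b c ⊎ TransClosure R c b
  deterministic⇒Star-comparable det ε ε = inj₁ refl
  deterministic⇒Star-comparable det ε (r ◅ q) = inj₂ (inj₁ (◅⇒⁺ r q))
  deterministic⇒Star-comparable det (r ◅ p) ε = inj₂ (inj₂ (◅⇒⁺ r p))
  deterministic⇒Star-comparable det (r ◅ p) (r′ ◅ q) with det r r′
  ... | refl = deterministic⇒Star-comparable det p q

⁺-map : ∀ {A : Set} {R S : A → A → Set} → (∀ {a b} → R a b → S a b) →
        ∀ {a b} → TransClosure R a b → TransClosure S a b
⁺-map f [ r ] = [ f r ]
⁺-map f (r ∷ p) = f r ∷ ⁺-map f p

s≢neg-s : ∀ s → s ≢ neg s
s≢neg-s plus ()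
s≢neg-s minus ()

neg[minus·s]≡s : ∀ s → neg (minus · s) ≡ s
neg[minus·s]≡s plus = refl
neg[minus·s]≡s minus = refl

module POPProperties (P : POP) where
  open POP P

  ≺[]⇒≺ : ∀ β {y x} → y ≺[ β ] x → y ≺ x
  ≺[]⇒≺ plus y≺x = inj₂ y≺x
  ≺[]⇒≺ minus y≺x = inj₁ y≺x

  ≺⇒≺[] : ∀ {y x} → y ≺ x → ∃ λ β → y ≺[ β ] x
  ≺⇒≺[] (inj₁ y≺x) = minus , y≺x
  ≺⇒≺[] (inj₂ y≺x) = plus , y≺x

  ≺[]-sign-unique : ∀ α β {y x} → y ≺[ α ] x → y ≺[ β ] x → α ≡ β
  ≺[]-sign-unique plus plus _ _ = refl
  ≺[]-sign-unique minus minus _ _ = refl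
  ≺[]-sign-unique plus minus y≺⁺x y≺⁻x = ⊥-elim (disjoint (y≺⁻x , y≺⁺x))
  ≺[]-sign-unique minus plus y≺⁻x y≺⁺x = ⊥-elim (disjoint (y≺⁻x , y≺⁺x))

  sign-product-unique : ∀ α β α′ β′ {z y x} → z ≺[ β ] y → y ≺[ α ] x →
                        z ≺[ β′ ] y → y ≺[ α′ ] x → α · β ≡ α′ · β′
  sign-product-unique α β α′ β′ zy yx zy′ yx′ =
    cong₂ _·_ (≺[]-sign-unique α α′ yx yx′) (≺[]-sign-unique β β′ zy zy′)

  ≺⇒dim< : ∀ {y x} → y ≺ x → dim y < dim x
  ≺⇒dim< y≺x = ≤-reflexive (sym (dim-≺ y≺x))

  ≺⇒1≤dim : ∀ {y x} → y ≺ x → 1 ≤ dim x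
  ≺⇒1≤dim y≺x = ≤-trans (s≤s z≤n) (≺⇒dim< y≺x)

  γ-of : ∀ x → 1 ≤ dim x → ∃ (_≺⁺ x)
  γ-of x 1≤dim with γ-unique x 1≤dim
  ... | g , g≺⁺x , _ = g , g≺⁺x

  ≺⁺-unique : ∀ {a b c} → a ≺⁺ c → b ≺⁺ c → a ≡ b
  ≺⁺-unique {a} {b} {c} a≺⁺c b≺⁺c with γ-unique c (≺⇒1≤dim (inj₂ a≺⁺c))
  ... | _ , _ , only = trans (only a a≺⁺c) (sym (only b b≺⁺c))

  codim-≺ : ∀ n {y x z} → y ≺ x → dim x ≡ suc n + dim z → dim y ≡ n + dim z
  codim-≺ n y≺x dx = suc-injective (trans (sym (dim-≺ y≺x)) dx)

  ≤P⇒dim≤ : ∀ {y x} → y ≤P x → dim y ≤ dim x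
  ≤P⇒dim≤ ε = ≤-refl
  ≤P⇒dim≤ (r ◅ p) = ≤-trans (<⇒≤ (≺⇒dim< r)) (≤P⇒dim≤ p)

  ≤P-dim≡⇒≡ : ∀ {y x} → y ≤P x → dim x ≡ dim y → y ≡ x
  ≤P-dim≡⇒≡ ε _ = refl
  ≤P-dim≡⇒≡ (r ◅ p) dx = ⊥-elim (<-irrefl (sym dx) (≤-trans (≺⇒dim< r) (≤P⇒dim≤ p)))

  ≤P-last : ∀ n {z x} → z ≤P x → dim x ≡ suc n + dim z →
            ∃ λ y → z ≤P y × y ≺ x × dim y ≡ n + dim z
  ≤P-last n {z} ε dx = ⊥-elim (<-irrefl refl (≤-trans (s≤s (m≤n+m (dim z) n)) (≤-reflexive (sym dx))))
  ≤P-last n (r ◅ p) dx with last-step r p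
  ... | y , z≤y , y≺x = y , z≤y , y≺x , codim-≺ n y≺x dx

  ≤P-codim1⇒≺ : ∀ {z x} → z ≤P x → dim x ≡ 1 + dim z → z ≺ x
  ≤P-codim1⇒≺ {x = x} z≤x dx with ≤P-last 0 z≤x dx
  ... | y , z≤y , y≺x , dy = subst (_≺ x) (sym (≤P-dim≡⇒≡ z≤y dy)) y≺x

  ≤P-codim2⇒≺≺ : ∀ {z x} → z ≤P x → dim x ≡ 2 + dim z → ∃ λ y → z ≺ y × y ≺ x
  ≤P-codim2⇒≺≺ z≤x dx with ≤P-last 1 z≤x dx
  ... | y , z≤y , y≺x , dy = y , ≤P-codim1⇒≺ z≤y dy , y≺x

  elements : List Elt
  elements = proj₁ finite

  position : Elt → Fin (length elements)
  position x = index (proj₂ finite x)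

  position-injective : ∀ {x y} → position x ≡ position y → x ≡ y
  position-injective {x} {y} same =
    trans (lookup-index (proj₂ finite x))
          (trans (cong (lookup elements) same) (sym (lookup-index (proj₂ finite y))))

module DendriticProperties (C : POP) (D : IsDendritic C) where
  open POP C
  open POPProperties C
  open IsDendritic D

  ≺-middle-unique : ∀ α β α′ β′ {z b b′ x} → z ≺[ β ] b → b ≺[ α ] x →
                    z ≺[ β′ ] b′ → b′ ≺[ α′ ] x → α · β ≡ α′ · β′ → b ≡ b′
  ≺-middle-unique α β α′ β′ {z} {b} {b′} {x} zb bx zb′ b′x same with thin α β zb bx
  ... | f , f≢b , (α₁ , β₁ , zf , fx , opposite) , _ with thin α₁ β₁ zf fx
  ... | _ , _ , _ , only-partner-of-f =
    trans (only-partner-of-f b (f≢b ∘ sym) (≺[]⇒≺ β zb) (≺[]⇒≺ α bx))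
          (sym (only-partner-of-f b′ b′≢f (≺[]⇒≺ β′ zb′) (≺[]⇒≺ α′ b′x)))
    where
      -- Instead of a case split on b′ ≡ b, both b and b′ are identified with the
      -- unique partner of f, from which they differ.
      b′≢f : b′ ≢ f
      b′≢f b′≡f = s≢neg-s (α₁ · β₁) (trans (sym (trans same same-as-f)) opposite)
        where
          same-as-f : α′ · β′ ≡ α₁ · β₁
          same-as-f = sign-product-unique α′ β′ α₁ β₁ zb′ b′x
                        (subst (z ≺[ β₁ ]_) (sym b′≡f) zf) (subst (_≺[ α₁ ] x) (sym b′≡f) fx)

  ≺⁺-partner : ∀ β {z y x} → z ≺[ β ] y → y ≺⁺ x → ∃ λ y′ → z ≺[ β ] y′ × y′ ≺⁻ x
  ≺⁺-partner β {z} zy yx with thin plus β zy yx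
  ... | y′ , y′≢y , (plus , _ , _ , y′x , _) , _ = ⊥-elim (y′≢y (≺⁺-unique y′x yx))
  ... | y′ , _ , (minus , β′ , zy′ , y′x , opposite) , _ =
    y′ , subst (λ s → z ≺[ s ] y′) (trans (sym (neg[minus·s]≡s β′)) (sym opposite)) zy′ , y′x

  ≺⁻≺⁻-partner : ∀ {g z y x} → g ≺⁺ x → z ≺⁻ y → y ≺⁻ x →
                 z ≺⁻ g ⊎ ∃ λ y′ → z ≺⁺ y′ × y′ ≺⁻ x
  ≺⁻≺⁻-partner {z = z} gx zy yx with thin minus minus zy yx
  ... | y′ , _ , (plus , minus , zy′ , y′x , _) , _ = inj₁ (subst (z ≺⁻_) (≺⁺-unique y′x gx) zy′)
  ... | y′ , _ , (minus , plus , zy′ , y′x , _) , _ = inj₂ (y′ , zy′ , y′x)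
  ... | _ , _ , (plus , plus , _ , _ , ()) , _
  ... | _ , _ , (minus , minus , _ , _ , ()) , _

  ≺⁺≺⁺-partner : ∀ {z y x} → z ≺⁺ y → y ≺⁺ x → ∃ λ y′ → z ≺⁺ y′ × y′ ≺⁻ x
  ≺⁺≺⁺-partner zy yx with thin plus plus zy yx
  ... | y′ , y′≢y , (plus , minus , _ , y′x , _) , _ = ⊥-elim (y′≢y (≺⁺-unique y′x yx))
  ... | y′ , _ , (minus , plus , zy′ , y′x , _) , _ = y′ , zy′ , y′x
  ... | _ , _ , (plus , plus , _ , _ , ()) , _
  ... | _ , _ , (minus , minus , _ , _ , ()) , _

  _◁⁺[_]_ : Elt → Elt → Elt → Set
  a ◁⁺[ x ] b = Σ Elt λ c → a ≺⁻ c × b ≺⁺ c × c ≺⁻ x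

  ◁⁺[]⇒◁⁺ : ∀ {a b x} → a ◁⁺[ x ] b → a ◁⁺ b
  ◁⁺[]⇒◁⁺ (c , a≺⁻c , b≺⁺c , _) = c , a≺⁻c , b≺⁺c

  ◁⁺[]-deterministic : ∀ {a b b′ x} → a ◁⁺[ x ] b → a ◁⁺[ x ] b′ → b ≡ b′
  ◁⁺[]-deterministic {b′ = b′} (c , ac , bc , cx) (c′ , ac′ , b′c′ , c′x) =
    ≺⁺-unique bc (subst (b′ ≺⁺_) (sym (≺-middle-unique minus minus minus minus ac cx ac′ c′x refl)) b′c′)

  no-long-γ∈δ-chain : ∀ {x} (ys : ℕ → Elt) → (∀ i → i ≤ length elements → ys i ≺⁻ x) →
                      ¬ (∀ i → i < length elements → γ∈δ (ys (suc i)) (ys i))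
  no-long-γ∈δ-chain {x} ys ys≺⁻x chain
    with pigeonhole (n<1+n (length elements)) (position ∘ ys ∘ toℕ)
  ... | i , j , i<j , same = cycle (toℕ i) (toℕ j) i<j (≤-pred (toℕ<n j)) (position-injective same)
    where
      cycle : ∀ i j → i < j → j ≤ length elements → ys i ≢ ys j
      cycle i j i<j j≤n repeat with m≤n⇒∃[o]m+o≡n i<j
      ... | o , refl = acyclic x (≺⇒1≤dim (inj₁ (ys≺⁻x 0 z≤n))) (o , ys ∘ (i +_) , in-δ , steps , closing)
        where
          in-δ : ∀ l → l ≤ o → ys (i + l) ≺⁻ x
          in-δ l l≤o = ys≺⁻x (i + l) (≤-trans (+-monoʳ-≤ i l≤o) (<⇒≤ j≤n))
          steps : ∀ l → l < o → γ∈δ (ys (i + suc l)) (ys (i + l))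
          steps l l<o = subst (λ k → γ∈δ (ys k) (ys (i + l))) (sym (+-suc i l))
                              (chain (i + l) (<-trans (+-monoʳ-< i l<o) j≤n))
          closing : γ∈δ (ys (i + 0)) (ys (i + o))
          closing = subst (λ y → γ∈δ y (ys (i + o))) (trans (sym repeat) (cong ys (sym (+-identityʳ i))))
                          (chain (i + o) j≤n)

  _⊏[_]_ : Elt → Elt → Elt → Set
  y′ ⊏[ x ] y = y′ ≺⁻ x × γ∈δ y′ y

  no-descent⇒acc : ∀ {x} n {y} →
                   (∀ (ys : ℕ → Elt) → ys 0 ≡ y → ¬ (∀ i → i < n → ys (suc i) ⊏[ x ] ys i)) →
                   Acc (_⊏[ x ]_) y
  no-descent⇒acc zero {y} no-descent = ⊥-elim (no-descent (λ _ → y) refl (λ _ ()))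
  no-descent⇒acc {x} (suc n) {y} no-descent = acc (λ y′⊏y → no-descent⇒acc n (no-descent-from y′⊏y))
    where
      no-descent-from : ∀ {y′} → y′ ⊏[ x ] y →
                        ∀ (ys : ℕ → Elt) → ys 0 ≡ y′ → ¬ (∀ i → i < n → ys (suc i) ⊏[ x ] ys i)
      no-descent-from y′⊏y ys refl descent = no-descent (λ { zero → y ; (suc i) → ys i }) refl
        λ { zero _ → y′⊏y ; (suc i) (s≤s i<n) → descent i i<n }

  ⊏-wellFounded : ∀ x → WellFounded (_⊏[ x ]_)
  ⊏-wellFounded x _ = no-descent⇒acc (suc (length elements)) λ ys _ descent →
    no-long-γ∈δ-chain (ys ∘ suc) (λ i i≤n → proj₁ (descent i (s≤s i≤n)))
                                 (λ i i<n → proj₂ (descent (suc i) (s≤s i<n)))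

  Landing : (x g z : Elt) → Sign → Elt → Set
  Landing x g z β d = ∃ λ b → z ≺[ β ] b × b ≺⁻ g × Star (_◁⁺[ x ]_) b d

  module _ {x g z : Elt} (β : Sign) (g≺⁺x : g ≺⁺ x) where

    descend-δ : ∀ {c d₁ d} → Acc (_⊏[ x ]_) c → z ≺[ β ] d₁ → d₁ ≺⁻ c → c ≺⁻ x →
                Star (_◁⁺[ x ]_) d₁ d → Landing x g z β d
    descend-δ {d₁ = d₁} (acc rec) zd₁ d₁c cx chain with ≺⁻≺⁻-partner g≺⁺x d₁c cx
    ... | inj₁ d₁g = d₁ , zd₁ , d₁g , chain
    ... | inj₂ (c′ , d₁c′ , c′x) with ≺⁺-partner β zd₁ d₁c′
    ... | d₂ , zd₂ , d₂c′ =
      descend-δ (rec (c′x , d₁ , d₁c′ , d₁c)) zd₂ d₂c′ c′x ((c′ , d₂c′ , d₁c′ , c′x) ◅ chain)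

    descend-⁺⁻ : ∀ {y d} → z ≺[ β ] d → d ≺⁺ y → y ≺⁻ x → Landing x g z β d
    descend-⁺⁻ {y} zd dy yx with ≺⁺-partner β zd dy
    ... | d₂ , zd₂ , d₂y = descend-δ (⊏-wellFounded x y) zd₂ d₂y yx ((y , d₂y , dy , yx) ◅ ε)

    descend : ∀ {y d} → z ≺[ β ] d → d ≺ y → y ≺ x → Landing x g z β d
    descend {y} zd (inj₁ dy) (inj₁ yx) = descend-δ (⊏-wellFounded x y) zd dy yx ε
    descend {d = d} zd (inj₁ dy) (inj₂ yx) = d , zd , subst (d ≺⁻_) (≺⁺-unique yx g≺⁺x) dy , ε
    descend zd (inj₂ dy) (inj₁ yx) = descend-⁺⁻ zd dy yx
    descend zd (inj₂ dy) (inj₂ yx) with ≺⁺≺⁺-partner dy yx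
    ... | _ , dy′ , y′x = descend-⁺⁻ zd dy′ y′x

  ≤P-γ : ∀ m {g x z} → g ≺⁺ x → z ≤P x → dim x ≡ 3 + m + dim z → z ≤P g
  ≤P-γ m g≺⁺x z≤x dx with ≤P-last (2 + m) z≤x dx
  ... | y , z≤y , y≺x , dy with ≤P-last (1 + m) z≤y dy
  ... | w , z≤w , w≺y , dw with ≤P-last m z≤w dw
  ... | u , z≤u , u≺w , _ with ≺⇒≺[] u≺w
  ... | β , u≺[β]w with descend β g≺⁺x u≺[β]w w≺y y≺x
  ... | _ , u≺b , b≺⁻g , _ = z≤u ◅◅ ≺[]⇒≺ β u≺b ◅ inj₁ b≺⁻g ◅ ε

  comparable-codim1 : ∀ β {e d d′ x} → e ≺[ β ] d → d ≺ x → e ≺[ β ] d′ → d′ ≺ x → d ≢ d′ →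
                      d <⁺ d′ ⊎ d′ <⁺ d
  comparable-codim1 β ed (inj₁ dx) ed′ (inj₁ d′x) d≢d′ =
    ⊥-elim (d≢d′ (≺-middle-unique minus β minus β ed dx ed′ d′x refl))
  comparable-codim1 β ed (inj₁ dx) ed′ (inj₂ d′x) _ = inj₁ [ _ , dx , d′x ]
  comparable-codim1 β ed (inj₂ dx) ed′ (inj₁ d′x) _ = inj₂ [ _ , d′x , dx ]
  comparable-codim1 β ed (inj₂ dx) ed′ (inj₂ d′x) d≢d′ = ⊥-elim (d≢d′ (≺⁺-unique dx d′x))

  comparable-codim2 : ∀ β {e d d′ y y′ x} → e ≺[ β ] d → d ≺ y → y ≺ x →
                      e ≺[ β ] d′ → d′ ≺ y′ → y′ ≺ x → d ≢ d′ → d <⁺ d′ ⊎ d′ <⁺ d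
  comparable-codim2 β ed dy yx ed′ d′y′ y′x d≢d′ with γ-of _ (≺⇒1≤dim yx)
  ... | g , g≺⁺x with descend β g≺⁺x ed dy yx | descend β g≺⁺x ed′ d′y′ y′x
  ... | b , eb , bg , b⋯d | b′ , eb′ , b′g , b′⋯d′
    with ≺-middle-unique minus β minus β eb bg eb′ b′g refl
  ... | refl with deterministic⇒Star-comparable ◁⁺[]-deterministic b⋯d b′⋯d′
  ... | inj₁ d≡d′ = ⊥-elim (d≢d′ d≡d′)
  ... | inj₂ (inj₁ d⋯d′) = inj₁ (⁺-map ◁⁺[]⇒◁⁺ d⋯d′)
  ... | inj₂ (inj₂ d′⋯d) = inj₂ (⁺-map ◁⁺[]⇒◁⁺ d′⋯d)

  comparable-below : ∀ m β {x e d d′} → d ≤P x → d′ ≤P x → dim x ≡ m + dim d → dim x ≡ m + dim d′ →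
                     e ≺[ β ] d → e ≺[ β ] d′ → d ≢ d′ → d <⁺ d′ ⊎ d′ <⁺ d
  comparable-below zero β d≤x d′≤x dx dx′ _ _ d≢d′ =
    ⊥-elim (d≢d′ (trans (≤P-dim≡⇒≡ d≤x dx) (sym (≤P-dim≡⇒≡ d′≤x dx′))))
  comparable-below 1 β d≤x d′≤x dx dx′ ed ed′ =
    comparable-codim1 β ed (≤P-codim1⇒≺ d≤x dx) ed′ (≤P-codim1⇒≺ d′≤x dx′)
  comparable-below 2 β d≤x d′≤x dx dx′ ed ed′ with ≤P-codim2⇒≺≺ d≤x dx | ≤P-codim2⇒≺≺ d′≤x dx′
  ... | _ , dy , yx | _ , d′y′ , y′x = comparable-codim2 β ed dy yx ed′ d′y′ y′x
  comparable-below (suc (suc (suc m))) β {x} d≤x d′≤x dx dx′ =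
    let _ , g≺⁺x = γ-of x (subst (1 ≤_) (sym dx) (s≤s z≤n)) in
    comparable-below (suc (suc m)) β (≤P-γ m g≺⁺x d≤x dx) (≤P-γ m g≺⁺x d′≤x dx′)
                     (codim-≺ (2 + m) (inj₂ g≺⁺x) dx) (codim-≺ (2 + m) (inj₂ g≺⁺x) dx′)

  cofaces-comparable : ∀ β {e d d′} → e ≺[ β ] d → e ≺[ β ] d′ → d ≢ d′ → d <⁺ d′ ⊎ d′ <⁺ d
  cofaces-comparable β {d = d} {d′} ed ed′ with greatest
  ... | ⊤ , below = comparable-below (dim ⊤ ∸ dim d) β (below d) (below d′) codim codim′ ed ed′
    where
      codim : dim ⊤ ≡ dim ⊤ ∸ dim d + dim d
      codim = sym (m∸n+n≡m (≤P⇒dim≤ (below d)))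
      codim′ : dim ⊤ ≡ dim ⊤ ∸ dim d + dim d′
      codim′ = trans codim (cong (dim ⊤ ∸ dim d +_)
                 (trans (dim-≺ (≺[]⇒≺ β ed)) (sym (dim-≺ (≺[]⇒≺ β ed′)))))

mainTheorem9 : (C : POP) → IsDendritic C →
    ∀ (k : ℕ) (e : POP.Elt C) → POP.dim C e ≡ k → ∀ (β : Sign) →
    ∀ (d d' : POP.Elt C) → POP.dim C d ≡ suc k → POP.dim C d' ≡ suc k →
    POP._≺[_]_ C e β d → POP._≺[_]_ C e β d' → d ≢ d' →
    POP._<⁺_ C d d' ⊎ POP._<⁺_ C d' d
-- The dimension hypotheses are redundant: e ≺ d and e ≺ d′ already force dim d ≡ dim d′.
mainTheorem9 C D _ _ _ β _ _ _ _ = DendriticProperties.cofaces-comparable C D β
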